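{- Let $H_1,\dots,H_r$ be pairwise non-isomorphic connected graphs and $\underline{H}=(H_1,\dots,H_r)$. Then the multivariate graph polynomial $Z_{\underline{H}}$ is multiplicative, i.e., for any two graphs $G_1,G_2$, $Z_{\underline{H}}(G_1\cup G_2;x)=Z_{\underline{H}}(G_1;x)\cdot Z_{\underline{H}}(G_2;x)$, where $G_1\cup G_2$ is the disjoint union. In particular, any evaluation of $Z_{\underline{H}}$ is also multiplicative.
   Context: For graphs $F,G$, $\mathrm{ind}(F,G)$ is the number of subsets $S\subseteq V(G)$ with $G[S]$ isomorphic to $F$. Let $h=(|V(H_1)|,\dots,|V(H_r)|)$. For $\gamma\in\mathbb{Z}_{\ge0}^r$, $\gamma\underline{H}$ denotes the disjoint union of $\gamma_1$ copies of $H_1$, ..., $\gamma_r$ copies of $H_r$; $\gamma\circ h$ is the pointwise product; for $x=(x_1,\dots,x_r)$ and $\mu\in\mathbb{Z}_{\ge0}^r$, $x^\mu=x_1^{\mu_1}\cdots x_r^{\mu_r}$. Define $Z_{\underline{H}}(G;x)=\sum_{\gamma\in\mathbb{Z}_{\ge0}^r}\mathrm{ind}(\gamma\underline{H},G)\,x^{\gamma\circ h}\in\mathbb{Z}[x_1,\dots,x_r]$. -}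

module Defs where

open import Data.Bool using (Bool; true; false; _∧_)
open import Data.Nat using (ℕ; zero; suc; _+_; _*_; _∸_; _≤_; _≤?_)
open import Data.Nat.Properties using (_≟_)
open import Data.Fin using (Fin; zero; suc; splitAt; _↑ˡ_; _↑ʳ_)
import Data.Fin.Properties as FinP
open import Data.Fin.Properties using (any?; all?)
open import Data.Vec using (Vec; []; _∷_; lookup; zipWith; replicate)
open import Data.List using (List; []; _∷_; map; concatMap; filter; length)
open import Data.Nat.ListAction using (sum)
open import Data.Sum using (_⊎_; inj₁; inj₂)
open import Data.Product using (Σ; ∃; _×_; _,_; proj₁; proj₂)
open import Data.Empty using (⊥)
open import Relation.Nullary using (Dec; yes; no; ¬_)
open import Relation.Nullary.Decidable using (_×-dec_; map′)
open import Relation.Binary.PropositionalEquality using (_≡_; refl; trans; cong; subst) renaming (sym to ≡-sym)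
import Data.Bool.Properties as BoolP

record Graph : Set where
  field
    n     : ℕ
    adj   : Fin n → Fin n → Bool
    sym   : ∀ i j → adj i j ≡ adj j i
    irref : ∀ i → adj i i ≡ false
open Graph public

∣V∣ : Graph → ℕ
∣V∣ = Graph.n

Bijective : ∀ {a b} → (Fin a → Fin b) → Set
Bijective f = (∀ i j → f i ≡ f j → i ≡ j) × (∀ y → ∃ λ x → f x ≡ y)

Iso : Graph → Graph → Set
Iso F G = Σ (Fin (n F) → Fin (n G)) λ f →
  Bijective f × (∀ i j → adj F i j ≡ adj G (f i) (f j))

private
  cons : ∀ {a b} → Fin b → (Fin a → Fin b) → Fin (suc a) → Fin b
  cons x g zero    = x
  cons x g (suc i) = g i

  decFun : ∀ a b (P : (Fin a → Fin b) → Set) →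
           (∀ f g → (∀ i → f i ≡ g i) → P f → P g) →
           (∀ f → Dec (P f)) → Dec (Σ (Fin a → Fin b) P)
  decFun zero b P resp P? with P? (λ ())
  ... | yes p = yes (_ , p)
  ... | no ¬p = no λ { (f , pf) → ¬p (resp f (λ ()) (λ ()) pf) }
  decFun (suc a) b P resp P? =
    map′ (λ { (x , g , p) → cons x g , p })
         (λ { (f , p) → f zero , (λ i → f (suc i)) ,
                        resp f _ (λ { zero → refl ; (suc i) → refl }) p })
         (any? λ x → decFun a b (λ g → P (cons x g))
                       (λ f g e p → resp _ _ (λ { zero → refl ; (suc i) → e i }) p)
                       (λ g → P? (cons x g)))

  IsoP : (F G : Graph) → (Fin (n F) → Fin (n G)) → Set
  IsoP F G f = Bijective f × (∀ i j → adj F i j ≡ adj G (f i) (f j))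

  isoResp : ∀ F G f g → (∀ i → f i ≡ g i) → IsoP F G f → IsoP F G g
  isoResp F G f g e ((inj , sur) , pres) =
    ((λ i j q → inj i j (trans (e i) (trans q (≡-sym (e j))))) ,
     (λ y → proj₁ (sur y) , trans (≡-sym (e (proj₁ (sur y)))) (proj₂ (sur y)))) ,
    (λ i j → trans (pres i j)
               (subst (λ z → adj G (f i) (f j) ≡ adj G z (g j)) (e i)
                 (cong (adj G (f i)) (e j))))

  isoP? : ∀ F G f → Dec (IsoP F G f)
  isoP? F G f =
    ((all? λ i → all? λ j → injDec (f i) (f j) i j) ×-dec
     (all? λ y → any? λ x → f x FinP.≟ y)) ×-dec
    (all? λ i → all? λ j → adj F i j BoolP.≟ adj G (f i) (f j))
    where
      injDec : ∀ {a b} (u v : Fin b) (i j : Fin a) →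
                                Dec (u ≡ v → i ≡ j)
      injDec u v i j with u FinP.≟ v | i FinP.≟ j
      ... | _     | yes e = yes (λ _ → e)
      ... | yes q | no ¬e = no λ h → ¬e (h q)
      ... | no ¬q | no _  = yes λ q → Data.Empty.⊥-elim (¬q q)
        where import Data.Empty

iso? : ∀ F G → Dec (Iso F G)
iso? F G = decFun (n F) (n G) (IsoP F G) (isoResp F G) (isoP? F G)

Subset : ℕ → Set
Subset k = Vec Bool k

allSubsets : ∀ k → List (Subset k)
allSubsets zero    = [] ∷ []
allSubsets (suc k) = concatMap (λ S → (false ∷ S) ∷ (true ∷ S) ∷ []) (allSubsets k)

size : ∀ {k} → Subset k → ℕ
size []          = zero
size (false ∷ S) = size S
size (true ∷ S)  = suc (size S)

elem : ∀ {k} (S : Subset k) → Fin (size S) → Fin k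
elem (false ∷ S) i       = suc (elem S i)
elem (true ∷ S)  zero    = zero
elem (true ∷ S)  (suc i) = suc (elem S i)

induced : (G : Graph) → Subset (n G) → Graph
induced G S = record
  { n     = size S
  ; adj   = λ i j → adj G (elem S i) (elem S j)
  ; sym   = λ i j → Graph.sym G (elem S i) (elem S j)
  ; irref = λ i → irref G (elem S i)
  }

ind : Graph → Graph → ℕ
ind F G = length (filter (λ S → iso? (induced G S) F) (allSubsets (n G)))

private
  unionAdj : ∀ {a b} → (Fin a → Fin a → Bool) → (Fin b → Fin b → Bool) →
             Fin a ⊎ Fin b → Fin a ⊎ Fin b → Bool
  unionAdj A B (inj₁ i) (inj₁ j) = A i j
  unionAdj A B (inj₂ i) (inj₂ j) = B i j
  unionAdj A B (inj₁ i) (inj₂ j) = false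
  unionAdj A B (inj₂ i) (inj₁ j) = false

  unionSym : ∀ {a b} (A : Fin a → Fin a → Bool) (B : Fin b → Fin b → Bool) →
             (∀ i j → A i j ≡ A j i) → (∀ i j → B i j ≡ B j i) →
             ∀ u v → unionAdj A B u v ≡ unionAdj A B v u
  unionSym A B sA sB (inj₁ i) (inj₁ j) = sA i j
  unionSym A B sA sB (inj₂ i) (inj₂ j) = sB i j
  unionSym A B sA sB (inj₁ i) (inj₂ j) = refl
  unionSym A B sA sB (inj₂ i) (inj₁ j) = refl

  unionIrr : ∀ {a b} (A : Fin a → Fin a → Bool) (B : Fin b → Fin b → Bool) →
             (∀ i → A i i ≡ false) → (∀ i → B i i ≡ false) →
             ∀ u → unionAdj A B u u ≡ false
  unionIrr A B iA iB (inj₁ i) = iA i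
  unionIrr A B iA iB (inj₂ i) = iB i

_∪_ : Graph → Graph → Graph
G₁ ∪ G₂ = record
  { n     = n G₁ + n G₂
  ; adj   = λ i j → unionAdj (adj G₁) (adj G₂) (splitAt (n G₁) i) (splitAt (n G₁) j)
  ; sym   = λ i j → unionSym (adj G₁) (adj G₂) (Graph.sym G₁) (Graph.sym G₂)
                      (splitAt (n G₁) i) (splitAt (n G₁) j)
  ; irref = λ i → unionIrr (adj G₁) (adj G₂) (irref G₁) (irref G₂) (splitAt (n G₁) i)
  }

emptyGraph : Graph
emptyGraph = record { n = 0 ; adj = λ () ; sym = λ () ; irref = λ () }

copies : ℕ → Graph → Graph
copies zero    H = emptyGraph
copies (suc k) H = H ∪ copies k H

_·_ : ∀ {r} → Vec ℕ r → Vec Graph r → Graph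
[]      · []      = emptyGraph
(g ∷ γ) · (H ∷ Hs) = copies g H ∪ (γ · Hs)

data Walk (G : Graph) : Fin (n G) → Fin (n G) → Set where
  here : ∀ {u} → Walk G u u
  step : ∀ {u v w} → adj G u v ≡ true → Walk G v w → Walk G u w

Connected : Graph → Set
Connected G = (1 ≤ n G) × (∀ u v → Walk G u v)

-- Multivariate polynomials in x₁..xᵣ with ℕ coefficients, represented by
-- their coefficient function on exponent vectors μ ∈ ℕ^r.

Poly : ℕ → Set
Poly r = Vec ℕ r → ℕ

box : ∀ {r} → Vec ℕ r → List (Vec ℕ r)
box []      = [] ∷ []
box (m ∷ μ) = concatMap (λ ν → map (λ k → k ∷ ν) (upto m)) (box μ)
  where
    upto : ℕ → List ℕ
    upto zero    = zero ∷ []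
    upto (suc k) = suc k ∷ upto k

_⊛_ : ∀ {r} → Poly r → Poly r → Poly r
(p ⊛ q) μ = sum (map (λ ν → p ν * q (zipWith _∸_ μ ν)) (box μ))

sizes : ∀ {r} → Vec Graph r → Vec ℕ r
sizes []       = []
sizes (H ∷ Hs) = n H ∷ sizes Hs

-- Z_H(G;x) = Σ_γ ind(γH, G) x^{γ∘h}; coefficient of x^μ is the sum of
-- ind(γH,G) over γ with γ∘h = μ.  Since every Hᵢ is connected (hence
-- nonempty, hᵢ ≥ 1), such γ satisfy γ ≤ μ, so it suffices to range over box μ.
Z : ∀ {r} → Vec Graph r → Graph → Poly r
Z Hs G μ = sum (map (λ γ → ind (γ · Hs) G)
                 (filter (λ γ → Data.Vec.Properties.≡-dec _≟_ (zipWith _*_ γ (sizes Hs)) μ)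
                   (box μ)))
  where import Data.Vec.Properties

module Submission where

-- Let Zspan H A ν count the γ with γ ∘ h = ν and A ≅ γH, i.e. the terms of Z(A) with S = V(A).
-- Then Z(G) = Σ_{S ⊆ V(G)} Zspan(G[S]); subsets of V(G₁ ∪ G₂) are pairs (S₁, S₂) with
-- (G₁ ∪ G₂)[S₁ ∪ S₂] ≅ G₁[S₁] ∪ G₂[S₂], so it suffices that Zspan(A ∪ B) = Zspan(A) · Zspan(B).
-- Since the Hᵢ are connected, every copy of an Hᵢ in A ∪ B ≅ γH lies inside A or inside B,
-- so A ≅ αH and B ≅ βH with α + β = γ.  Since they are moreover pairwise non-isomorphic,
-- γH determines γ; hence Zspan(A) is the monomial x^(α∘h) if A ≅ αH, and 0 if A is no such union.

open import Defs hiding (sym)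

open import Algebra.Properties.CommutativeSemigroup using (interchange)
open import Data.Bool using (true; false; not)
open import Data.Empty using (⊥-elim)
open import Data.Fin using (Fin; zero; suc; splitAt; _↑ˡ_; _↑ʳ_)
open import Data.Fin.Properties
  using (suc-injective; ¬Fin0; splitAt-↑ˡ; splitAt-↑ʳ; splitAt⁻¹-↑ˡ; splitAt⁻¹-↑ʳ; ↑ˡ-injective; ↑ʳ-injective;
         injective⇒≤)
open import Data.Fin.Subset using (∁; ⊤; ⊥)
open import Data.List using (List; []; _∷_; map; concatMap; filter; length)
import Data.List.Properties as List
open import Data.Nat using (ℕ; zero; suc; _+_; _*_; _∸_; _≤_; z≤n; s≤s)
open import Data.Nat.ListAction using (sum)
open import Data.Nat.ListAction.Properties using (sum-++)
open import Data.Nat.Properties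
  using (_≟_; ≤-refl; ≤-antisym; <-irrefl; m≤n⇒m≤1+n; m≤n⇒m<n∨m≡n; m≤m+n; m+[n∸m]≡n; m+n∸m≡n; m+n≡0⇒m≡0;
         m+n≡0⇒n≡0; +-identityˡ; +-identityʳ; +-suc; +-commutativeSemigroup; *-zeroʳ; *-identityʳ; *-comm;
         *-distribˡ-+; *-distribʳ-+; *-monoʳ-≤)
open import Data.Product using (∃; _×_; _,_; proj₁; proj₂)
open import Data.Sum using (_⊎_; inj₁; inj₂; [_,_]′)
open import Data.Vec using (Vec; []; _∷_; lookup; tabulate; _++_; replicate; take; drop; zipWith)
open import Data.Vec.Properties
  using (≡-dec; ∷-injective; zipWith-identityˡ; zipWith-distribʳ; lookup-map; lookup-++ˡ; lookup-++ʳ;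
         lookup∘tabulate; lookup-replicate; map-++; map-replicate; take++drop≡id)
open import Data.Vec.Relation.Binary.Pointwise.Inductive using (Pointwise; []; _∷_)
open import Function using (case_of_; _∘_)
open import Relation.Binary.Bundles using (Setoid)
open import Relation.Binary.PropositionalEquality
import Relation.Binary.Reasoning.Setoid as SetoidReasoning
open import Relation.Nullary using (¬_; Dec; yes; no)
open import Relation.Unary using (Pred; Decidable)

-- Isomorphisms and induced embeddings

infix 4 _≅_

record _≅_ (G G′ : Graph) : Set where
  field
    to      : Fin (n G) → Fin (n G′)
    from    : Fin (n G′) → Fin (n G)
    from-to : ∀ x → from (to x) ≡ x
    to-from : ∀ y → to (from y) ≡ y
    adj-to  : ∀ i j → adj G i j ≡ adj G′ (to i) (to j)

open _≅_

to-injective : ∀ {G G′} (f : G ≅ G′) {i j} → to f i ≡ to f j → i ≡ j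
to-injective f {i} {j} p = trans (sym (from-to f i)) (trans (cong (from f) p) (from-to f j))

≅⇒Iso : ∀ {G G′} → G ≅ G′ → Iso G G′
≅⇒Iso f = to f , ((λ i j → to-injective f) , (λ y → from f y , to-from f y)) , adj-to f

Iso⇒≅ : ∀ {G G′} → Iso G G′ → G ≅ G′
Iso⇒≅ (f , (injective , surjective) , adj-f) = record
  { to      = f
  ; from    = λ y → proj₁ (surjective y)
  ; from-to = λ x → injective _ _ (proj₂ (surjective (f x)))
  ; to-from = λ y → proj₂ (surjective y)
  ; adj-to  = adj-f
  }

≅-refl : ∀ {G} → G ≅ G
≅-refl = record
  { to = λ x → x ; from = λ x → x ; from-to = λ _ → refl ; to-from = λ _ → refl ; adj-to = λ _ _ → refl }

≅-sym : ∀ {G G′} → G ≅ G′ → G′ ≅ G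
≅-sym {G} {G′} f = record
  { to      = from f
  ; from    = to f
  ; from-to = to-from f
  ; to-from = from-to f
  ; adj-to  = λ i j → sym (trans (adj-to f (from f i) (from f j))
                               (cong₂ (adj G′) (to-from f i) (to-from f j)))
  }

≅-trans : ∀ {G G′ G″} → G ≅ G′ → G′ ≅ G″ → G ≅ G″
≅-trans f g = record
  { to      = λ x → to g (to f x)
  ; from    = λ y → from f (from g y)
  ; from-to = λ x → trans (cong (from f) (from-to g (to f x))) (from-to f x)
  ; to-from = λ y → trans (cong (to g) (to-from f (from g y))) (to-from g y)
  ; adj-to  = λ i j → trans (adj-to f i j) (adj-to g (to f i) (to f j))
  }

≅-setoid : Setoid _ _
≅-setoid = record
  { Carrier       = Graph
  ; _≈_           = _≅_
  ; isEquivalence = record { refl = ≅-refl ; sym = ≅-sym ; trans = ≅-trans }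
  }

module ≅-Reasoning = SetoidReasoning ≅-setoid

≅⇒∣V∣≡ : ∀ {G G′} → G ≅ G′ → ∣V∣ G ≡ ∣V∣ G′
≅⇒∣V∣≡ f = ≤-antisym (injective⇒≤ (to-injective f)) (injective⇒≤ (to-injective (≅-sym f)))

∣V∣≡0⇒≅empty : ∀ G → ∣V∣ G ≡ 0 → G ≅ emptyGraph
∣V∣≡0⇒≅empty G e = record
  { to = absurd ; from = λ () ; from-to = λ x → absurd x ; to-from = λ () ; adj-to = λ i → absurd i }
  where
    absurd : ∀ {A : Set} → Fin (n G) → A
    absurd x = ⊥-elim (¬Fin0 (subst Fin e x))

data Side (m k : ℕ) : Fin (m + k) → Set where
  left  : (a : Fin m) → Side m k (a ↑ˡ k)
  right : (b : Fin k) → Side m k (m ↑ʳ b)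

side : ∀ m k (y : Fin (m + k)) → Side m k y
side m k y with splitAt m y in eq
... | inj₁ a = subst (Side m k) (splitAt⁻¹-↑ˡ eq) (left a)
... | inj₂ b = subst (Side m k) (splitAt⁻¹-↑ʳ eq) (right b)

↑ˡ≢↑ʳ : ∀ {m k} (a : Fin m) (b : Fin k) → a ↑ˡ k ≢ m ↑ʳ b
↑ˡ≢↑ʳ {m} {k} a b p with trans (sym (splitAt-↑ˡ m a k)) (trans (cong (splitAt m) p) (splitAt-↑ʳ m k b))
... | ()

module _ (X Y : Graph) where

  adj-↑ˡ : ∀ a b → adj (X ∪ Y) (a ↑ˡ n Y) (b ↑ˡ n Y) ≡ adj X a b
  adj-↑ˡ a b rewrite splitAt-↑ˡ (n X) a (n Y) | splitAt-↑ˡ (n X) b (n Y) = refl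

  adj-↑ʳ : ∀ a b → adj (X ∪ Y) (n X ↑ʳ a) (n X ↑ʳ b) ≡ adj Y a b
  adj-↑ʳ a b rewrite splitAt-↑ʳ (n X) (n Y) a | splitAt-↑ʳ (n X) (n Y) b = refl

  adj-↑ˡ↑ʳ : ∀ a b → adj (X ∪ Y) (a ↑ˡ n Y) (n X ↑ʳ b) ≡ false
  adj-↑ˡ↑ʳ a b rewrite splitAt-↑ˡ (n X) a (n Y) | splitAt-↑ʳ (n X) (n Y) b = refl


infix 4 _↪_

record _↪_ (X G : Graph) : Set where
  field
    emb           : Fin (n X) → Fin (n G)
    emb-injective : ∀ {i j} → emb i ≡ emb j → i ≡ j
    adj-emb       : ∀ i j → adj X i j ≡ adj G (emb i) (emb j)

open _↪_

Image : ∀ {X G} → X ↪ G → Fin (n G) → Set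
Image f y = ∃ λ i → emb f i ≡ y

≅⇒↪ : ∀ {X G} → X ≅ G → X ↪ G
≅⇒↪ f = record { emb = to f ; emb-injective = to-injective f ; adj-emb = adj-to f }

↪-onto⇒≅ : ∀ {X G} (f : X ↪ G) → (∀ y → Image f y) → X ≅ G
↪-onto⇒≅ f onto = record
  { to      = emb f
  ; from    = λ y → proj₁ (onto y)
  ; from-to = λ x → emb-injective f (proj₂ (onto (emb f x)))
  ; to-from = λ y → proj₂ (onto y)
  ; adj-to  = adj-emb f
  }

↪-refl : ∀ {X} → X ↪ X
↪-refl = record { emb = λ x → x ; emb-injective = λ p → p ; adj-emb = λ _ _ → refl }

infixr 9 _∘↪_

_∘↪_ : ∀ {X G K} → G ↪ K → X ↪ G → X ↪ K
g ∘↪ f = record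
  { emb           = λ x → emb g (emb f x)
  ; emb-injective = λ p → emb-injective f (emb-injective g p)
  ; adj-emb       = λ i j → trans (adj-emb f i j) (adj-emb g _ _)
  }

↪∪ˡ : ∀ {X Y} → X ↪ X ∪ Y
↪∪ˡ {X} {Y} = record
  { emb = _↑ˡ n Y ; emb-injective = ↑ˡ-injective (n Y) _ _ ; adj-emb = λ i j → sym (adj-↑ˡ X Y i j) }

↪∪ʳ : ∀ {X Y} → Y ↪ X ∪ Y
↪∪ʳ {X} {Y} = record
  { emb = n X ↑ʳ_ ; emb-injective = ↑ʳ-injective (n X) _ _ ; adj-emb = λ i j → sym (adj-↑ʳ X Y i j) }

record Apart {X Y G} (f : X ↪ G) (g : Y ↪ G) : Set where
  field
    distinct    : ∀ i j → emb f i ≢ emb g j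
    nonadjacent : ∀ i j → adj G (emb f i) (emb g j) ≡ false

open Apart

apart-∪ : ∀ {X Y} → Apart (↪∪ˡ {X} {Y}) ↪∪ʳ
apart-∪ {X} {Y} = record { distinct = ↑ˡ≢↑ʳ ; nonadjacent = adj-↑ˡ↑ʳ X Y }

apart-sym : ∀ {X Y G} {f : X ↪ G} {g : Y ↪ G} → Apart f g → Apart g f
apart-sym {G = G} {f} {g} fg = record
  { distinct    = λ j i p → distinct fg i j (sym p)
  ; nonadjacent = λ j i → trans (Graph.sym G (emb g j) (emb f i)) (nonadjacent fg i j)
  }

apart-∘ : ∀ {X Y X′ Y′ G} {f : X ↪ G} {g : Y ↪ G} → Apart f g →
          (a : X′ ↪ X) (b : Y′ ↪ Y) → Apart (f ∘↪ a) (g ∘↪ b)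
apart-∘ fg a b = record
  { distinct    = λ i j → distinct fg (emb a i) (emb b j)
  ; nonadjacent = λ i j → nonadjacent fg (emb a i) (emb b j)
  }

module Copair {X Y G} (f : X ↪ G) (g : Y ↪ G) (fg : Apart f g) where

  private
    e : Fin (n X) ⊎ Fin (n Y) → Fin (n G)
    e (inj₁ i) = emb f i
    e (inj₂ j) = emb g j

  copair : X ∪ Y ↪ G
  copair = record
    { emb = λ x → e (splitAt (n X) x) ; emb-injective = injective _ _ ; adj-emb = adj-copair }
    where
      injective : ∀ x y → e (splitAt (n X) x) ≡ e (splitAt (n X) y) → x ≡ y
      injective x y p with side (n X) (n Y) x | side (n X) (n Y) y
      ... | left a  | left b  rewrite splitAt-↑ˡ (n X) a (n Y) | splitAt-↑ˡ (n X) b (n Y) =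
        cong (_↑ˡ n Y) (emb-injective f p)
      ... | right a | right b rewrite splitAt-↑ʳ (n X) (n Y) a | splitAt-↑ʳ (n X) (n Y) b =
        cong (n X ↑ʳ_) (emb-injective g p)
      ... | left a  | right b rewrite splitAt-↑ˡ (n X) a (n Y) | splitAt-↑ʳ (n X) (n Y) b =
        ⊥-elim (distinct fg a b p)
      ... | right a | left b  rewrite splitAt-↑ʳ (n X) (n Y) a | splitAt-↑ˡ (n X) b (n Y) =
        ⊥-elim (distinct fg b a (sym p))

      adj-copair : ∀ x y → adj (X ∪ Y) x y ≡ adj G (e (splitAt (n X) x)) (e (splitAt (n X) y))
      adj-copair x y with side (n X) (n Y) x | side (n X) (n Y) y
      ... | left a  | left b  rewrite splitAt-↑ˡ (n X) a (n Y) | splitAt-↑ˡ (n X) b (n Y) = adj-emb f a b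
      ... | right a | right b rewrite splitAt-↑ʳ (n X) (n Y) a | splitAt-↑ʳ (n X) (n Y) b = adj-emb g a b
      ... | left a  | right b rewrite splitAt-↑ˡ (n X) a (n Y) | splitAt-↑ʳ (n X) (n Y) b =
        sym (nonadjacent fg a b)
      ... | right a | left b  rewrite splitAt-↑ʳ (n X) (n Y) a | splitAt-↑ˡ (n X) b (n Y) =
        sym (nonadjacent (apart-sym fg) a b)

  image-copairˡ : ∀ {y} → Image f y → Image copair y
  image-copairˡ (i , p) = i ↑ˡ n Y , trans (cong e (splitAt-↑ˡ (n X) i (n Y))) p

  image-copairʳ : ∀ {y} → Image g y → Image copair y
  image-copairʳ (j , p) = n X ↑ʳ j , trans (cong e (splitAt-↑ʳ (n X) (n Y) j)) p

  apart-copair : ∀ {Z} (h : Z ↪ G) → Apart f h → Apart g h → Apart copair h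
  apart-copair h fh gh = record { distinct = distinct′ ; nonadjacent = nonadjacent′ }
    where
      distinct′ : ∀ x k → emb copair x ≢ emb h k
      distinct′ x k with side (n X) (n Y) x
      ... | left a  rewrite splitAt-↑ˡ (n X) a (n Y) = distinct fh a k
      ... | right b rewrite splitAt-↑ʳ (n X) (n Y) b = distinct gh b k
      nonadjacent′ : ∀ x k → adj G (emb copair x) (emb h k) ≡ false
      nonadjacent′ x k with side (n X) (n Y) x
      ... | left a  rewrite splitAt-↑ˡ (n X) a (n Y) = nonadjacent fh a k
      ... | right b rewrite splitAt-↑ʳ (n X) (n Y) b = nonadjacent gh b k

  copair-onto⇒≅ : (∀ y → Image f y ⊎ Image g y) → X ∪ Y ≅ G
  copair-onto⇒≅ onto = ↪-onto⇒≅ copair λ y → [ image-copairˡ , image-copairʳ ]′ (onto y)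

open Copair using (copair; copair-onto⇒≅)

∪-cong : ∀ {X X′ Y Y′} → X ≅ X′ → Y ≅ Y′ → X ∪ Y ≅ X′ ∪ Y′
∪-cong {X} {X′} {Y} {Y′} f g = copair-onto⇒≅ toX toY (apart-∘ apart-∪ (≅⇒↪ f) (≅⇒↪ g)) onto
  where
    toX : X ↪ X′ ∪ Y′
    toX = ↪∪ˡ ∘↪ ≅⇒↪ f
    toY : Y ↪ X′ ∪ Y′
    toY = ↪∪ʳ ∘↪ ≅⇒↪ g
    onto : ∀ y → Image toX y ⊎ Image toY y
    onto y with side (n X′) (n Y′) y
    ... | left a  = inj₁ (from f a , cong (_↑ˡ n Y′) (to-from f a))
    ... | right b = inj₂ (from g b , cong (n X′ ↑ʳ_) (to-from g b))

∪-comm : ∀ {X Y} → X ∪ Y ≅ Y ∪ X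
∪-comm {X} {Y} = copair-onto⇒≅ (↪∪ʳ {Y} {X}) ↪∪ˡ (apart-sym apart-∪) onto
  where
    onto : ∀ y → Image (↪∪ʳ {Y} {X}) y ⊎ Image (↪∪ˡ {Y} {X}) y
    onto y with side (n Y) (n X) y
    ... | left a  = inj₂ (a , refl)
    ... | right b = inj₁ (b , refl)

∪-assoc : ∀ {X Y Z} → (X ∪ Y) ∪ Z ≅ X ∪ (Y ∪ Z)
∪-assoc {X} {Y} {Z} = copair-onto⇒≅ toXY toZ XY-Z onto
  where
    toX : X ↪ X ∪ (Y ∪ Z)
    toX = ↪∪ˡ {X} {Y ∪ Z}
    toY : Y ↪ X ∪ (Y ∪ Z)
    toY = ↪∪ʳ {X} {Y ∪ Z} ∘↪ ↪∪ˡ {Y} {Z}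
    toZ : Z ↪ X ∪ (Y ∪ Z)
    toZ = ↪∪ʳ {X} {Y ∪ Z} ∘↪ ↪∪ʳ {Y} {Z}
    X-Y : Apart toX toY
    X-Y = apart-∘ (apart-∪ {X} {Y ∪ Z}) ↪-refl (↪∪ˡ {Y} {Z})
    toXY : X ∪ Y ↪ X ∪ (Y ∪ Z)
    toXY = copair toX toY X-Y
    XY-Z : Apart toXY toZ
    XY-Z = Copair.apart-copair toX toY X-Y toZ (apart-∘ (apart-∪ {X} {Y ∪ Z}) ↪-refl (↪∪ʳ {Y} {Z}))
             (record { distinct    = λ a b p → ↑ˡ≢↑ʳ a b (↑ʳ-injective (n X) _ _ p)
                     ; nonadjacent = λ a b → trans (adj-↑ʳ X (Y ∪ Z) _ _) (adj-↑ˡ↑ʳ Y Z a b) })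
    onto : ∀ y → Image toXY y ⊎ Image toZ y
    onto y with side (n X) (n Y + n Z) y
    ... | left a = inj₁ (Copair.image-copairˡ toX toY X-Y (a , refl))
    ... | right b with side (n Y) (n Z) b
    ...   | left c  = inj₁ (Copair.image-copairʳ toX toY X-Y (c , refl))
    ...   | right c = inj₂ (c , refl)

∪-identityˡ : ∀ {G} → emptyGraph ∪ G ≅ G
∪-identityˡ = ≅-refl

∪-identityʳ : ∀ {G} → G ∪ emptyGraph ≅ G
∪-identityʳ {G} = ∪-comm {G} {emptyGraph}

∪-interchange : ∀ {A B C D} → (A ∪ B) ∪ (C ∪ D) ≅ (A ∪ C) ∪ (B ∪ D)
∪-interchange {A} {B} {C} {D} = begin
  (A ∪ B) ∪ (C ∪ D) ≈⟨ ∪-assoc {A} {B} {C ∪ D} ⟩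
  A ∪ (B ∪ (C ∪ D)) ≈⟨ ∪-cong (≅-refl {A}) (∪-assoc {B} {C} {D}) ⟨
  A ∪ ((B ∪ C) ∪ D) ≈⟨ ∪-cong (≅-refl {A}) (∪-cong (∪-comm {B} {C}) (≅-refl {D})) ⟩
  A ∪ ((C ∪ B) ∪ D) ≈⟨ ∪-cong (≅-refl {A}) (∪-assoc {C} {B} {D}) ⟩
  A ∪ (C ∪ (B ∪ D)) ≈⟨ ∪-assoc {A} {C} {B ∪ D} ⟨
  (A ∪ C) ∪ (B ∪ D) ∎
  where open ≅-Reasoning

-- Induced subgraphs

index : ∀ {k} (S : Subset k) x → lookup S x ≡ true → Fin (size S)
index (false ∷ S) zero    ()
index (false ∷ S) (suc x) p = index S x p
index (true ∷ S)  zero    p = zero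
index (true ∷ S)  (suc x) p = suc (index S x p)

elem-index : ∀ {k} (S : Subset k) x p → elem S (index S x p) ≡ x
elem-index (false ∷ S) zero    ()
elem-index (false ∷ S) (suc x) p = cong suc (elem-index S x p)
elem-index (true ∷ S)  zero    p = refl
elem-index (true ∷ S)  (suc x) p = cong suc (elem-index S x p)

lookup-elem : ∀ {k} (S : Subset k) i → lookup S (elem S i) ≡ true
lookup-elem (false ∷ S) i       = lookup-elem S i
lookup-elem (true ∷ S)  zero    = refl
lookup-elem (true ∷ S)  (suc i) = lookup-elem S i

elem-injective : ∀ {k} (S : Subset k) {i j} → elem S i ≡ elem S j → i ≡ j
elem-injective (false ∷ S)                 p  = elem-injective S (suc-injective p)
elem-injective (true ∷ S) {zero}  {zero}   _  = refl
elem-injective (true ∷ S) {suc i} {suc j}  p  = cong suc (elem-injective S (suc-injective p))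
elem-injective (true ∷ S) {zero}  {suc j} ()
elem-injective (true ∷ S) {suc i} {zero}  ()

size≡0⇒lookup≡false : ∀ {k} (S : Subset k) → size S ≡ 0 → ∀ x → lookup S x ≡ false
size≡0⇒lookup≡false (false ∷ S) e zero    = refl
size≡0⇒lookup≡false (false ∷ S) e (suc x) = size≡0⇒lookup≡false S e x

lookup-∁ : ∀ {k} (S : Subset k) x → lookup (∁ S) x ≡ not (lookup S x)
lookup-∁ S x = lookup-map x not S

induced↪ : ∀ G (S : Subset (n G)) → induced G S ↪ G
induced↪ G S = record { emb = elem S ; emb-injective = elem-injective S ; adj-emb = λ _ _ → refl }

↪⇒≅induced : ∀ {K} G (S : Subset (n G)) (f : K ↪ G) →
             (∀ i → lookup S (emb f i) ≡ true) → (∀ x → lookup S x ≡ true → Image f x) →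
             K ≅ induced G S
↪⇒≅induced {K} G S f into onto = ↪-onto⇒≅ f′ onto′
  where
    f′ : K ↪ induced G S
    f′ = record
      { emb           = λ i → index S (emb f i) (into i)
      ; emb-injective = λ {i} {j} p → emb-injective f
          (trans (sym (elem-index S _ (into i))) (trans (cong (elem S) p) (elem-index S _ (into j))))
      ; adj-emb       = λ i j → trans (adj-emb f i j)
          (sym (cong₂ (adj G) (elem-index S _ (into i)) (elem-index S _ (into j))))
      }
    onto′ : ∀ y → Image f′ y
    onto′ y with onto (elem S y) (lookup-elem S y)
    ... | i , p = i , elem-injective S (trans (elem-index S _ (into i)) p)

induced-full : ∀ G (S : Subset (n G)) → (∀ x → lookup S x ≡ true) → G ≅ induced G S
induced-full G S full = ↪⇒≅induced G S ↪-refl full (λ x _ → x , refl)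

induced-≅ : ∀ {G G′} (f : G ≅ G′) (S : Subset (n G)) (S′ : Subset (n G′)) →
            (∀ x → lookup S′ (to f x) ≡ lookup S x) → induced G S ≅ induced G′ S′
induced-≅ {G} {G′} f S S′ same = ↪⇒≅induced G′ S′ (≅⇒↪ f ∘↪ induced↪ G S) into onto
  where
    into : ∀ i → lookup S′ (to f (elem S i)) ≡ true
    into i = trans (same _) (lookup-elem S i)
    onto : ∀ y → lookup S′ y ≡ true → Image (≅⇒↪ f ∘↪ induced↪ G S) y
    onto y q = index S (from f y) q′ , trans (cong (to f) (elem-index S _ q′)) (to-from f y)
      where q′ = trans (sym (same (from f y))) (trans (cong (lookup S′) (to-from f y)) q)

induced-∪ : ∀ A B (S₁ : Subset (n A)) (S₂ : Subset (n B)) →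
            induced A S₁ ∪ induced B S₂ ≅ induced (A ∪ B) (S₁ ++ S₂)
induced-∪ A B S₁ S₂ = ↪⇒≅induced (A ∪ B) (S₁ ++ S₂) (copair toA toB apart) into onto
  where
    toA : induced A S₁ ↪ A ∪ B
    toA = ↪∪ˡ ∘↪ induced↪ A S₁
    toB : induced B S₂ ↪ A ∪ B
    toB = ↪∪ʳ ∘↪ induced↪ B S₂
    apart : Apart toA toB
    apart = apart-∘ apart-∪ (induced↪ A S₁) (induced↪ B S₂)
    into : ∀ i → lookup (S₁ ++ S₂) (emb (copair toA toB apart) i) ≡ true
    into i with side (size S₁) (size S₂) i
    ... | left a  rewrite splitAt-↑ˡ (size S₁) a (size S₂) = trans (lookup-++ˡ S₁ S₂ _) (lookup-elem S₁ a)
    ... | right b rewrite splitAt-↑ʳ (size S₁) (size S₂) b = trans (lookup-++ʳ S₁ S₂ _) (lookup-elem S₂ b)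
    onto : ∀ x → lookup (S₁ ++ S₂) x ≡ true → Image (copair toA toB apart) x
    onto x q with side (n A) (n B) x
    ... | left a = Copair.image-copairˡ toA toB apart (index S₁ a q′ , cong (_↑ˡ n B) (elem-index S₁ a q′))
      where q′ = trans (sym (lookup-++ˡ S₁ S₂ a)) q
    ... | right b = Copair.image-copairʳ toA toB apart (index S₂ b q′ , cong (n A ↑ʳ_) (elem-index S₂ b q′))
      where q′ = trans (sym (lookup-++ʳ S₁ S₂ b)) q

Closed : (G : Graph) → Subset (n G) → Set
Closed G S = ∀ u v → lookup S u ≡ true → lookup S v ≡ false → adj G u v ≡ false

closed-split : ∀ G (S : Subset (n G)) → Closed G S → induced G S ∪ induced G (∁ S) ≅ G
closed-split G S closed = copair-onto⇒≅ (induced↪ G S) (induced↪ G (∁ S)) apart onto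
  where
    not≡true : ∀ {b} → not b ≡ true → b ≡ false
    not≡true {false} _ = refl
    outside : ∀ j → lookup S (elem (∁ S) j) ≡ false
    outside j = not≡true (trans (sym (lookup-∁ S _)) (lookup-elem (∁ S) j))
    apart : Apart (induced↪ G S) (induced↪ G (∁ S))
    apart = record
      { distinct    = λ i j p → case trans (sym (lookup-elem S i)) (trans (cong (lookup S) p) (outside j)) of λ ()
      ; nonadjacent = λ i j → closed _ _ (lookup-elem S i) (outside j)
      }
    onto : ∀ y → Image (induced↪ G S) y ⊎ Image (induced↪ G (∁ S)) y
    onto y with lookup S y in eq
    ... | true  = inj₁ (index S y eq , elem-index S y eq)
    ... | false = inj₂ (index (∁ S) y eq′ , elem-index (∁ S) y eq′)
      where eq′ = trans (lookup-∁ S y) (cong not eq)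

-- Connected summands

walk-≅ : ∀ {G G′} (f : G ≅ G′) {u v} → Walk G u v → Walk G′ (to f u) (to f v)
walk-≅ f here                = here
walk-≅ f (step {u} {v} e w) = step (trans (sym (adj-to f u v)) e) (walk-≅ f w)

connected-≅ : ∀ {G G′} → G ≅ G′ → Connected G → Connected G′
connected-≅ {G′ = G′} f (nonempty , walk) =
  subst (1 ≤_) (≅⇒∣V∣≡ f) nonempty ,
  λ u v → subst₂ (Walk G′) (to-from f u) (to-from f v) (walk-≅ f (walk (from f u) (from f v)))

walk-stays-left : ∀ X Y {a v} → Walk (X ∪ Y) (a ↑ˡ n Y) v → ∃ λ a′ → a′ ↑ˡ n Y ≡ v
walk-stays-left X Y here = _ , refl
walk-stays-left X Y {a} (step {v = w} e walk) with side (n X) (n Y) w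
... | left a′ = walk-stays-left X Y walk
... | right b = case trans (sym e) (adj-↑ˡ↑ʳ X Y a b) of λ ()

zero⊎Fin : ∀ m → m ≡ 0 ⊎ Fin m
zero⊎Fin zero    = inj₁ refl
zero⊎Fin (suc m) = inj₂ zero

connected-∪ : ∀ X Y → Connected (X ∪ Y) → n X ≡ 0 ⊎ n Y ≡ 0
connected-∪ X Y (_ , walk) with zero⊎Fin (n X) | zero⊎Fin (n Y)
... | inj₁ e | _      = inj₁ e
... | inj₂ _ | inj₁ e = inj₂ e
... | inj₂ a | inj₂ b = ⊥-elim (↑ˡ≢↑ʳ _ b (proj₂ (walk-stays-left X Y (walk (a ↑ˡ n Y) (n X ↑ʳ b)))))

size-⊥ : ∀ k → size (⊥ {k}) ≡ 0
size-⊥ zero    = refl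
size-⊥ (suc k) = size-⊥ k

induced-⊤++⊥ : ∀ H R → H ≅ induced (H ∪ R) (⊤ {n H} ++ ⊥ {n R})
induced-⊤++⊥ H R = begin
  H                                  ≈⟨ induced-full H ⊤ (λ x → lookup-replicate x true) ⟩
  induced H ⊤                        ≈⟨ ∪-identityʳ ⟨
  induced H ⊤ ∪ emptyGraph           ≈⟨ ∪-cong ≅-refl (∣V∣≡0⇒≅empty (induced R ⊥) (size-⊥ (n R))) ⟨
  induced H ⊤ ∪ induced R ⊥          ≈⟨ induced-∪ H R ⊤ ⊥ ⟩
  induced (H ∪ R) (⊤ {n H} ++ ⊥ {n R}) ∎
  where open ≅-Reasoning

induced-⊥++⊤ : ∀ H R → R ≅ induced (H ∪ R) (⊥ {n H} ++ ⊤ {n R})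
induced-⊥++⊤ H R = begin
  R                                  ≈⟨ induced-full R ⊤ (λ x → lookup-replicate x true) ⟩
  induced R ⊤                        ≈⟨ ∪-identityˡ ⟨
  emptyGraph ∪ induced R ⊤           ≈⟨ ∪-cong (∣V∣≡0⇒≅empty (induced H ⊥) (size-⊥ (n H))) ≅-refl ⟨
  induced H ⊥ ∪ induced R ⊤          ≈⟨ induced-∪ H R ⊥ ⊤ ⟩
  induced (H ∪ R) (⊥ {n H} ++ ⊤ {n R})           ∎
  where open ≅-Reasoning

∁-⊤++⊥ : ∀ m k → ∁ (⊤ {m} ++ ⊥ {k}) ≡ ⊥ {m} ++ ⊤ {k}
∁-⊤++⊥ m k = trans (map-++ not (⊤ {m}) (⊥ {k})) (cong₂ _++_ (map-replicate not true m) (map-replicate not false k))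

⊤++⊥-closed : ∀ H R → Closed (H ∪ R) (⊤ {n H} ++ ⊥ {n R})
⊤++⊥-closed H R u v p q with side (n H) (n R) u | side (n H) (n R) v
... | left a  | right b = adj-↑ˡ↑ʳ H R a b
... | left a  | left b  =
  case trans (sym (lookup-replicate b true)) (trans (sym (lookup-++ˡ (⊤ {n H}) (⊥ {n R}) b)) q) of λ ()
... | right a | _       =
  case trans (sym (lookup-replicate a false)) (trans (sym (lookup-++ʳ (⊤ {n H}) (⊥ {n R}) a)) p) of λ ()

closed-≅ : ∀ {G G′} (f : G ≅ G′) S S′ →
           (∀ x → lookup S′ (to f x) ≡ lookup S x) → Closed G S → Closed G′ S′
closed-≅ {G} {G′} f S S′ same closed u v p q =
  trans (cong₂ (adj G′) (sym (to-from f u)) (sym (to-from f v)))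
    (trans (sym (adj-to f (from f u) (from f v)))
      (closed _ _ (trans (sym (same _)) (trans (cong (lookup S′) (to-from f u)) p))
                  (trans (sym (same _)) (trans (cong (lookup S′) (to-from f v)) q))))

closed-++ˡ : ∀ X Y (S₁ : Subset (n X)) (S₂ : Subset (n Y)) → Closed (X ∪ Y) (S₁ ++ S₂) → Closed X S₁
closed-++ˡ X Y S₁ S₂ closed u v p q =
  trans (sym (adj-↑ˡ X Y u v)) (closed _ _ (trans (lookup-++ˡ S₁ S₂ u) p) (trans (lookup-++ˡ S₁ S₂ v) q))

closed-++ʳ : ∀ X Y (S₁ : Subset (n X)) (S₂ : Subset (n Y)) → Closed (X ∪ Y) (S₁ ++ S₂) → Closed Y S₂
closed-++ʳ X Y S₁ S₂ closed u v p q =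
  trans (sym (adj-↑ʳ X Y u v)) (closed _ _ (trans (lookup-++ʳ S₁ S₂ u) p) (trans (lookup-++ʳ S₁ S₂ v) q))

induced-∁-of-empty : ∀ G (S : Subset (n G)) → size S ≡ 0 → induced G (∁ S) ≅ G
induced-∁-of-empty G S e =
  ≅-sym (induced-full G (∁ S) (λ x → trans (lookup-∁ S x) (cong not (size≡0⇒lookup≡false S e x))))

closed-absorb : ∀ {H} G (S : Subset (n G)) → Closed G S → H ≅ induced G S → G ≅ H ∪ induced G (∁ S)
closed-absorb G S closed h = ≅-trans (≅-sym (closed-split G S closed)) (∪-cong (≅-sym h) ≅-refl)

connected-summand : ∀ {H R X Y} → Connected H → H ∪ R ≅ X ∪ Y →
  (∃ λ X′ → X ≅ H ∪ X′ × R ≅ X′ ∪ Y) ⊎ (∃ λ Y′ → Y ≅ H ∪ Y′ × R ≅ X ∪ Y′)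
connected-summand {H} {R} {X} {Y} H-connected f = conclude (connected-∪ _ _ (connected-≅ H-split H-connected))
  where
    -- P marks the vertices of H and Q their image in X ∪ Y.
    P : Subset (n H + n R)
    P = ⊤ {n H} ++ ⊥ {n R}
    Q : Subset (n X + n Y)
    Q = tabulate (λ w → lookup P (from f w))
    lookup-Q : ∀ x → lookup Q (to f x) ≡ lookup P x
    lookup-Q x = trans (lookup∘tabulate _ (to f x)) (cong (lookup P) (from-to f x))
    Q₁ : Subset (n X)
    Q₁ = take (n X) Q
    Q₂ : Subset (n Y)
    Q₂ = drop (n X) Q
    Q-closed : Closed (X ∪ Y) (Q₁ ++ Q₂)
    Q-closed = subst (Closed (X ∪ Y)) (sym (take++drop≡id (n X) Q)) (closed-≅ f P Q lookup-Q (⊤++⊥-closed H R))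

    H-split : H ≅ induced X Q₁ ∪ induced Y Q₂
    H-split = begin
      H                               ≈⟨ induced-⊤++⊥ H R ⟩
      induced (H ∪ R) P               ≈⟨ induced-≅ f P Q lookup-Q ⟩
      induced (X ∪ Y) Q               ≡⟨ cong (induced (X ∪ Y)) (take++drop≡id (n X) Q) ⟨
      induced (X ∪ Y) (Q₁ ++ Q₂)      ≈⟨ induced-∪ X Y Q₁ Q₂ ⟨
      induced X Q₁ ∪ induced Y Q₂     ∎
      where open ≅-Reasoning

    R-split : R ≅ induced X (∁ Q₁) ∪ induced Y (∁ Q₂)
    R-split = begin
      R                               ≈⟨ induced-⊥++⊤ H R ⟩
      induced (H ∪ R) (⊥ {n H} ++ ⊤) ≡⟨ cong (induced (H ∪ R)) (∁-⊤++⊥ (n H) (n R)) ⟨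
      induced (H ∪ R) (∁ P)           ≈⟨ induced-≅ f (∁ P) (∁ Q) lookup-∁Q ⟩
      induced (X ∪ Y) (∁ Q)           ≡⟨ cong (induced (X ∪ Y) ∘ ∁) (take++drop≡id (n X) Q) ⟨
      induced (X ∪ Y) (∁ (Q₁ ++ Q₂))  ≡⟨ cong (induced (X ∪ Y)) (map-++ not Q₁ Q₂) ⟩
      induced (X ∪ Y) (∁ Q₁ ++ ∁ Q₂)  ≈⟨ induced-∪ X Y (∁ Q₁) (∁ Q₂) ⟨
      induced X (∁ Q₁) ∪ induced Y (∁ Q₂) ∎
      where
        open ≅-Reasoning
        lookup-∁Q : ∀ x → lookup (∁ Q) (to f x) ≡ lookup (∁ P) x
        lookup-∁Q x = trans (lookup-∁ Q _) (trans (cong not (lookup-Q x)) (sym (lookup-∁ P x)))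

    conclude : size Q₁ ≡ 0 ⊎ size Q₂ ≡ 0 →
      (∃ λ X′ → X ≅ H ∪ X′ × R ≅ X′ ∪ Y) ⊎ (∃ λ Y′ → Y ≅ H ∪ Y′ × R ≅ X ∪ Y′)
    conclude (inj₂ Q₂-empty) = inj₁ (induced X (∁ Q₁) ,
      closed-absorb X Q₁ (closed-++ˡ X Y Q₁ Q₂ Q-closed)
        (≅-trans H-split (≅-trans (∪-cong ≅-refl (∣V∣≡0⇒≅empty (induced Y Q₂) Q₂-empty)) ∪-identityʳ)) ,
      ≅-trans R-split (∪-cong ≅-refl (induced-∁-of-empty Y Q₂ Q₂-empty)))
    conclude (inj₁ Q₁-empty) = inj₂ (induced Y (∁ Q₂) ,
      closed-absorb Y Q₂ (closed-++ʳ X Y Q₁ Q₂ Q-closed)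
        (≅-trans H-split (∪-cong (∣V∣≡0⇒≅empty (induced X Q₁) Q₁-empty) ≅-refl)) ,
      ≅-trans R-split (∪-cong (induced-∁-of-empty X Q₁ Q₁-empty) ≅-refl))

-- Disjoint unions of copies of H₁, …, Hᵣ

infixl 6 _⊕_

_⊕_ : ∀ {r} → Vec ℕ r → Vec ℕ r → Vec ℕ r
_⊕_ = zipWith _+_

copies-+ : ∀ a b H → copies a H ∪ copies b H ≅ copies (a + b) H
copies-+ zero    b H = ∪-identityˡ
copies-+ (suc a) b H = ≅-trans (∪-assoc {H} {copies a H} {copies b H}) (∪-cong ≅-refl (copies-+ a b H))

·-⊕ : ∀ {r} (Hs : Vec Graph r) α β → (α · Hs) ∪ (β · Hs) ≅ (α ⊕ β) · Hs
·-⊕ []       []      []      = ∪-identityˡ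
·-⊕ (H ∷ Hs) (a ∷ α) (b ∷ β) =
  ≅-trans (∪-interchange {copies a H} {α · Hs} {copies b H} {β · Hs}) (∪-cong (copies-+ a b H) (·-⊕ Hs α β))

record Splitting {r} (Hs : Vec Graph r) (A B : Graph) (γ : Vec ℕ r) : Set where
  constructor splitting
  field
    {α β} : Vec ℕ r
    α⊕β≡γ : α ⊕ β ≡ γ
    A≅    : A ≅ α · Hs
    B≅    : B ≅ β · Hs

·-split : ∀ {r} (Hs : Vec Graph r) → (∀ i → Connected (lookup Hs i)) →
          ∀ γ {A B} → A ∪ B ≅ γ · Hs → Splitting Hs A B γ
·-split []       _    []      {A} {B} f =
  splitting refl (∣V∣≡0⇒≅empty A (m+n≡0⇒m≡0 (n A) (≅⇒∣V∣≡ f)))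
                 (∣V∣≡0⇒≅empty B (m+n≡0⇒n≡0 (n A) (≅⇒∣V∣≡ f)))
·-split (H ∷ Hs) conn (g ∷ γ) = split-copies g
  where
    one-more-left : ∀ {A A′ B g} → A ≅ H ∪ A′ →
                    Splitting (H ∷ Hs) A′ B (g ∷ γ) → Splitting (H ∷ Hs) A B (suc g ∷ γ)
    one-more-left A≅ (splitting {a ∷ α} {b ∷ β} e A′≅ B≅) =
      splitting {α = suc a ∷ α} {b ∷ β} (cong (λ { (c ∷ v) → suc c ∷ v }) e)
        (≅-trans A≅ (≅-trans (∪-cong ≅-refl A′≅) (≅-sym (∪-assoc {H} {copies a H} {α · Hs})))) B≅

    one-more-right : ∀ {A B B′ g} → B ≅ H ∪ B′ →
                     Splitting (H ∷ Hs) A B′ (g ∷ γ) → Splitting (H ∷ Hs) A B (suc g ∷ γ)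
    one-more-right B≅ (splitting {a ∷ α} {b ∷ β} e A≅ B′≅) =
      splitting {α = a ∷ α} {suc b ∷ β}
        (trans (cong (_∷ α ⊕ β) (+-suc a b)) (cong (λ { (c ∷ v) → suc c ∷ v }) e)) A≅
        (≅-trans B≅ (≅-trans (∪-cong ≅-refl B′≅) (≅-sym (∪-assoc {H} {copies b H} {β · Hs}))))

    split-copies : ∀ g {A B} → A ∪ B ≅ (g ∷ γ) · (H ∷ Hs) → Splitting (H ∷ Hs) A B (g ∷ γ)
    split-copies zero f =
      let splitting {α} {β} e A≅ B≅ = ·-split Hs (conn ∘ suc) γ f
      in  splitting {α = 0 ∷ α} {0 ∷ β} (cong (0 ∷_) e) A≅ B≅
    split-copies (suc g) f =
      [ (λ { (_ , A≅ , rest) → one-more-left  A≅ (split-copies g (≅-sym rest)) }) ,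
        (λ { (_ , B≅ , rest) → one-more-right B≅ (split-copies g (≅-sym rest)) }) ]′
      (connected-summand (conn zero) (≅-sym (≅-trans f (∪-assoc {H} {copies g H} {γ · Hs}))))

unit : ∀ {r} → Fin r → Vec ℕ r
unit zero    = 1 ∷ replicate _ 0
unit (suc i) = 0 ∷ unit i

copies-empty : ∀ {H} → 1 ≤ n H → ∀ g → n (copies g H) ≡ 0 → g ≡ 0
copies-empty _            zero    _ = refl
copies-empty {H} nonempty (suc g) e = case subst (1 ≤_) (m+n≡0⇒m≡0 (n H) e) nonempty of λ ()

·-empty : ∀ {r} (Hs : Vec Graph r) → (∀ i → 1 ≤ n (lookup Hs i)) →
          ∀ γ → n (γ · Hs) ≡ 0 → γ ≡ replicate r 0
·-empty []       _        []      _ = refl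
·-empty (H ∷ Hs) nonempty (g ∷ γ) e =
  cong₂ _∷_ (copies-empty (nonempty zero) g (m+n≡0⇒m≡0 _ e)) (·-empty Hs (nonempty ∘ suc) γ (m+n≡0⇒n≡0 _ e))

·-connected : ∀ {r} (Hs : Vec Graph r) → (∀ i → 1 ≤ n (lookup Hs i)) →
              ∀ γ {K} → Connected K → K ≅ γ · Hs → ∃ λ i → γ ≡ unit i × K ≅ lookup Hs i
·-connected [] _ [] (K-nonempty , _) f = case subst (1 ≤_) (≅⇒∣V∣≡ f) K-nonempty of λ ()
·-connected (H ∷ Hs) nonempty (zero ∷ γ) K-connected f
  with ·-connected Hs (nonempty ∘ suc) γ K-connected f
... | i , e , g = suc i , cong (0 ∷_) e , g
·-connected (H ∷ Hs) nonempty (suc g ∷ γ) {K} K-connected f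
  with connected-∪ (H ∪ copies g H) (γ · Hs) (connected-≅ f K-connected)
... | inj₁ e = case subst (1 ≤_) (m+n≡0⇒m≡0 (n H) e) (nonempty zero) of λ ()
... | inj₂ γ-empty = lone-copy (connected-∪ H (copies g H) (connected-≅ K≅ K-connected))
  where
    K≅ : K ≅ H ∪ copies g H
    K≅ = ≅-trans f (≅-trans (∪-cong ≅-refl (∣V∣≡0⇒≅empty (γ · Hs) γ-empty)) ∪-identityʳ)
    lone-copy : n H ≡ 0 ⊎ n (copies g H) ≡ 0 → ∃ λ i → suc g ∷ γ ≡ unit i × K ≅ lookup (H ∷ Hs) i
    lone-copy (inj₁ e)        = case subst (1 ≤_) e (nonempty zero) of λ ()
    lone-copy (inj₂ gH-empty) =
      zero ,
      cong₂ _∷_ (cong suc (copies-empty (nonempty zero) g gH-empty)) (·-empty Hs (nonempty ∘ suc) γ γ-empty) ,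
      ≅-trans K≅ (≅-trans (∪-cong ≅-refl (∣V∣≡0⇒≅empty (copies g H) gH-empty)) ∪-identityʳ)

·-injective : ∀ {r} (Hs : Vec Graph r) → (∀ i → Connected (lookup Hs i)) →
              (∀ i j → i ≢ j → ¬ Iso (lookup Hs i) (lookup Hs j)) →
              ∀ α β → α · Hs ≅ β · Hs → α ≡ β
·-injective []       _    _        []      []      _ = refl
·-injective (H ∷ Hs) conn distinct (a ∷ α) (b ∷ β) = cancel a b
  where
    distinct-tail : ∀ i j → i ≢ j → ¬ Iso (lookup Hs i) (lookup Hs j)
    distinct-tail i j i≢j = distinct (suc i) (suc j) (i≢j ∘ suc-injective)

    H-multiple : ∀ {ε} → H ≅ ε · (H ∷ Hs) → ε ≡ unit zero
    H-multiple {ε} f with ·-connected (H ∷ Hs) (proj₁ ∘ conn) ε (conn zero) f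
    ... | zero  , e , _ = e
    ... | suc j , _ , g = ⊥-elim (distinct zero (suc j) (λ ()) (≅⇒Iso g))

    remove-H : ∀ {R} c γ → H ∪ R ≅ (c ∷ γ) · (H ∷ Hs) →
               ∃ λ c′ → c ≡ suc c′ × R ≅ (c′ ∷ γ) · (H ∷ Hs)
    remove-H c γ f with ·-split (H ∷ Hs) conn (c ∷ γ) f
    ... | splitting {ε} {ρ₀ ∷ ρ} e H≅ R≅ with H-multiple {ε} H≅
    ... | refl = ρ₀ , sym (proj₁ (∷-injective e)) ,
      subst (λ v → _ ≅ (ρ₀ ∷ v) · (H ∷ Hs))
            (trans (sym (zipWith-identityˡ +-identityˡ ρ)) (proj₂ (∷-injective e))) R≅

    cancel : ∀ a b → (a ∷ α) · (H ∷ Hs) ≅ (b ∷ β) · (H ∷ Hs) → a ∷ α ≡ b ∷ β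
    cancel zero    zero    f = cong (0 ∷_) (·-injective Hs (conn ∘ suc) distinct-tail α β f)
    cancel zero    (suc b) f =
      case proj₁ (proj₂ (remove-H 0 α (≅-sym (≅-trans f (∪-assoc {H} {copies b H} {β · Hs}))))) of λ ()
    cancel (suc a) b       f =
      let b′ , b≡ , g = remove-H b β (≅-trans (≅-sym (∪-assoc {H} {copies a H} {α · Hs})) f)
      in trans (cong (λ { (c ∷ v) → suc c ∷ v }) (cancel a b′ g)) (cong (_∷ β) (sym b≡))

-- Finite sums

∑ : ∀ {A : Set} → List A → (A → ℕ) → ℕ
∑ xs f = sum (map f xs)

syntax ∑ xs (λ x → e) = ∑[ x ∈ xs ] e

∑-cong : ∀ {A : Set} (xs : List A) {f g : A → ℕ} → (∀ x → f x ≡ g x) → ∑ xs f ≡ ∑ xs g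
∑-cong []       _ = refl
∑-cong (x ∷ xs) h = cong₂ _+_ (h x) (∑-cong xs h)

∑-≡0 : ∀ {A : Set} (xs : List A) {f : A → ℕ} → (∀ x → f x ≡ 0) → ∑ xs f ≡ 0
∑-≡0 []       _ = refl
∑-≡0 (x ∷ xs) h = cong₂ _+_ (h x) (∑-≡0 xs h)

∑-≢0 : ∀ {A : Set} (xs : List A) (f : A → ℕ) → ∑ xs f ≢ 0 → ∃ λ x → f x ≢ 0
∑-≢0 []       f ∑≢0 = ⊥-elim (∑≢0 refl)
∑-≢0 (x ∷ xs) f ∑≢0 with f x ≟ 0
... | no  fx≢0 = x , fx≢0
... | yes fx≡0 = ∑-≢0 xs f (λ e → ∑≢0 (cong₂ _+_ fx≡0 e))

∑-+ : ∀ {A : Set} (xs : List A) (f g : A → ℕ) → ∑[ x ∈ xs ] (f x + g x) ≡ ∑ xs f + ∑ xs g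
∑-+ []       f g = refl
∑-+ (x ∷ xs) f g =
  trans (cong (f x + g x +_) (∑-+ xs f g)) (interchange +-commutativeSemigroup (f x) (g x) (∑ xs f) (∑ xs g))

∑-*ˡ : ∀ {A : Set} (c : ℕ) (xs : List A) (f : A → ℕ) → c * ∑ xs f ≡ ∑[ x ∈ xs ] (c * f x)
∑-*ˡ c []       f = *-zeroʳ c
∑-*ˡ c (x ∷ xs) f = trans (*-distribˡ-+ c (f x) _) (cong (c * f x +_) (∑-*ˡ c xs f))

∑-swap : ∀ {A B : Set} (xs : List A) (ys : List B) (f : A → B → ℕ) →
         ∑[ x ∈ xs ] ∑[ y ∈ ys ] f x y ≡ ∑[ y ∈ ys ] ∑[ x ∈ xs ] f x y
∑-swap []       ys f = sym (∑-≡0 ys (λ _ → refl))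
∑-swap (x ∷ xs) ys f =
  trans (cong (∑ ys (f x) +_) (∑-swap xs ys f)) (sym (∑-+ ys (f x) (λ y → ∑[ x ∈ xs ] f x y)))

∑-* : ∀ {A B : Set} (xs : List A) (ys : List B) (f : A → ℕ) (g : B → ℕ) →
      ∑ xs f * ∑ ys g ≡ ∑[ x ∈ xs ] ∑[ y ∈ ys ] (f x * g y)
∑-* xs ys f g = trans (*-comm (∑ xs f) _) (trans (∑-*ˡ (∑ ys g) xs f)
  (∑-cong xs (λ x → trans (*-comm (∑ ys g) (f x)) (∑-*ˡ (f x) ys g))))

∑-concatMap : ∀ {A B : Set} (g : A → List B) (xs : List A) (f : B → ℕ) →
              ∑ (concatMap g xs) f ≡ ∑[ x ∈ xs ] ∑ (g x) f
∑-concatMap g []       f = refl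
∑-concatMap g (x ∷ xs) f =
  trans (cong sum (List.map-++ f (g x) _))
    (trans (sum-++ (map f (g x)) _) (cong (∑ (g x) f +_) (∑-concatMap g xs f)))

χ : ∀ {P : Set} → Dec P → ℕ
χ (yes _) = 1
χ (no _)  = 0

χ-yes : ∀ {P : Set} (d : Dec P) → P → χ d ≡ 1
χ-yes (yes _) _ = refl
χ-yes (no ¬p) p = ⊥-elim (¬p p)

χ*χ≡0 : ∀ {P Q : Set} (d : Dec P) (e : Dec Q) → (P → ¬ Q) → χ d * χ e ≡ 0
χ*χ≡0 (yes p) (yes q) ¬pq = ⊥-elim (¬pq p q)
χ*χ≡0 (yes _) (no _)  _   = refl
χ*χ≡0 (no _)  _       _   = refl

χ*χ≢0 : ∀ {P Q : Set} (d : Dec P) (e : Dec Q) → χ d * χ e ≢ 0 → P × Q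
χ*χ≢0 (yes p) (yes q) _  = p , q
χ*χ≢0 (yes _) (no _)  ≢0 = ⊥-elim (≢0 refl)
χ*χ≢0 (no _)  _       ≢0 = ⊥-elim (≢0 refl)

∑-filter : ∀ {A : Set} {P : Pred A _} (P? : Decidable P) (xs : List A) (g : A → ℕ) →
           ∑ (filter P? xs) g ≡ ∑[ x ∈ xs ] (χ (P? x) * g x)
∑-filter P? []       g = refl
∑-filter P? (x ∷ xs) g with P? x
... | yes _ = cong₂ _+_ (sym (+-identityʳ (g x))) (∑-filter P? xs g)
... | no  _ = ∑-filter P? xs g

length-filter : ∀ {A : Set} {P : Pred A _} (P? : Decidable P) (xs : List A) →
                length (filter P? xs) ≡ ∑[ x ∈ xs ] χ (P? x)
length-filter P? []       = refl
length-filter P? (x ∷ xs) with P? x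
... | yes _ = cong suc (length-filter P? xs)
... | no  _ = length-filter P? xs

infix 4 _≤ᵛ_

_≤ᵛ_ : ∀ {r} → Vec ℕ r → Vec ℕ r → Set
_≤ᵛ_ = Pointwise _≤_

∑-box-zero : ∀ {r} (μ : Vec ℕ r) f → ∑ (box (0 ∷ μ)) f ≡ ∑[ ν ∈ box μ ] f (0 ∷ ν)
∑-box-zero μ f = trans (∑-concatMap _ (box μ) f) (∑-cong (box μ) (λ ν → +-identityʳ _))

∑-box-suc : ∀ {r} m (μ : Vec ℕ r) f →
            ∑ (box (suc m ∷ μ)) f ≡ ∑[ ν ∈ box μ ] f (suc m ∷ ν) + ∑ (box (m ∷ μ)) f
∑-box-suc m μ f = trans (∑-concatMap _ (box μ) f)
  (trans (∑-+ (box μ) (λ ν → f (suc m ∷ ν)) _)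
         (cong (∑[ ν ∈ box μ ] f (suc m ∷ ν) +_) (sym (∑-concatMap _ (box μ) f))))

∑-box-≡0 : ∀ {r} (μ : Vec ℕ r) f → (∀ ν → ν ≤ᵛ μ → f ν ≡ 0) → ∑ (box μ) f ≡ 0
∑-box-≡0 []      f h = cong (_+ 0) (h [] [])
∑-box-≡0 (m ∷ μ) f h = go m (λ a ν a≤ ν≤ → h (a ∷ ν) (a≤ ∷ ν≤))
  where
    go : ∀ m → (∀ a ν → a ≤ m → ν ≤ᵛ μ → f (a ∷ ν) ≡ 0) → ∑ (box (m ∷ μ)) f ≡ 0
    go zero    h = trans (∑-box-zero μ f) (∑-box-≡0 μ _ (λ ν → h 0 ν z≤n))
    go (suc m) h = trans (∑-box-suc m μ f)
      (cong₂ _+_ (∑-box-≡0 μ _ (λ ν → h (suc m) ν ≤-refl)) (go m (λ a ν a≤m → h a ν (m≤n⇒m≤1+n a≤m))))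

∑-box-single : ∀ {r} (μ : Vec ℕ r) f x → x ≤ᵛ μ → (∀ ν → ν ≢ x → f ν ≡ 0) → ∑ (box μ) f ≡ f x
∑-box-single []      f [] [] h = +-identityʳ _
∑-box-single (m ∷ μ) f (a ∷ x) (a≤m ∷ x≤μ) h = go m a≤m
  where
    off-x : ∀ {a′} ν → ν ≢ x → f (a′ ∷ ν) ≡ 0
    off-x ν ν≢x = h _ (λ e → ν≢x (proj₂ (∷-injective e)))
    go : ∀ m → a ≤ m → ∑ (box (m ∷ μ)) f ≡ f (a ∷ x)
    go zero    z≤n = trans (∑-box-zero μ f) (∑-box-single μ _ x x≤μ off-x)
    go (suc m) a≤  with m≤n⇒m<n∨m≡n a≤
    ... | inj₂ refl = trans (∑-box-suc m μ f)
      (trans (cong₂ _+_ (∑-box-single μ _ x x≤μ off-x)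
                       (∑-box-≡0 (m ∷ μ) f λ { (b ∷ ν) (b≤m ∷ _) →
                         h _ (λ e → <-irrefl (proj₁ (∷-injective e)) (s≤s b≤m)) }))
             (+-identityʳ _))
    ... | inj₁ (s≤s a≤m) = trans (∑-box-suc m μ f)
      (cong₂ _+_ (∑-box-≡0 μ _ (λ ν _ → h _ (λ e → <-irrefl (sym (proj₁ (∷-injective e))) (s≤s a≤m))))
                 (go m a≤m))

infix 4 _≟ᵛ_

_≟ᵛ_ : ∀ {r} (u v : Vec ℕ r) → Dec (u ≡ v)
_≟ᵛ_ = ≡-dec _≟_

⊕-∸ : ∀ {r} {ν μ : Vec ℕ r} → ν ≤ᵛ μ → ν ⊕ zipWith _∸_ μ ν ≡ μ
⊕-∸ []          = refl
⊕-∸ (a≤b ∷ ν≤μ) = cong₂ _∷_ (m+[n∸m]≡n a≤b) (⊕-∸ ν≤μ)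

∸-⊕ : ∀ {r} (ν ρ : Vec ℕ r) → zipWith _∸_ (ν ⊕ ρ) ν ≡ ρ
∸-⊕ []      []      = refl
∸-⊕ (a ∷ ν) (b ∷ ρ) = cong₂ _∷_ (m+n∸m≡n a b) (∸-⊕ ν ρ)

≤ᵛ-⊕ : ∀ {r} (ν ρ : Vec ℕ r) → ν ≤ᵛ ν ⊕ ρ
≤ᵛ-⊕ []      []      = []
≤ᵛ-⊕ (a ∷ ν) (b ∷ ρ) = m≤m+n a b ∷ ≤ᵛ-⊕ ν ρ

-- x^a · x^b = x^(a ⊕ b).  Restricting ν to the box μ is what makes μ ∸ ν exact.
δ⊛δ : ∀ {r} (a b μ : Vec ℕ r) → ((λ ν → χ (a ≟ᵛ ν)) ⊛ (λ ν → χ (b ≟ᵛ ν))) μ ≡ χ (a ⊕ b ≟ᵛ μ)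
δ⊛δ a b μ with a ⊕ b ≟ᵛ μ
... | yes refl =
  trans (∑-box-single (a ⊕ b) _ a (≤ᵛ-⊕ a b) (λ ν ν≢a → χ*χ≡0 (a ≟ᵛ ν) _ (λ a≡ν _ → ν≢a (sym a≡ν))))
        (cong₂ _*_ (χ-yes (a ≟ᵛ a) refl) (χ-yes (b ≟ᵛ _) (sym (∸-⊕ a b))))
... | no a⊕b≢μ = ∑-box-≡0 μ _ λ ν ν≤μ → χ*χ≡0 (a ≟ᵛ ν) (b ≟ᵛ _)
  (λ a≡ν b≡μ∸ν → a⊕b≢μ (trans (cong₂ _⊕_ a≡ν b≡μ∸ν) (⊕-∸ ν≤μ)))

⊛-cong : ∀ {r} {p p′ q q′ : Poly r} → (∀ ν → p ν ≡ p′ ν) → (∀ ν → q ν ≡ q′ ν) →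
         ∀ μ → (p ⊛ q) μ ≡ (p′ ⊛ q′) μ
⊛-cong p≗p′ q≗q′ μ = ∑-cong (box μ) (λ ν → cong₂ _*_ (p≗p′ ν) (q≗q′ _))

⊛-∑ : ∀ {r} {A B : Set} (xs : List A) (ys : List B) (p : A → Poly r) (q : B → Poly r) μ →
      ((λ ν → ∑[ x ∈ xs ] p x ν) ⊛ (λ ν → ∑[ y ∈ ys ] q y ν)) μ ≡ ∑[ x ∈ xs ] ∑[ y ∈ ys ] (p x ⊛ q y) μ
⊛-∑ xs ys p q μ = begin
  ∑[ ν ∈ box μ ] (∑[ x ∈ xs ] p x ν * ∑[ y ∈ ys ] q y (zipWith _∸_ μ ν))
    ≡⟨ ∑-cong (box μ) (λ ν → ∑-* xs ys _ _) ⟩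
  ∑[ ν ∈ box μ ] ∑[ x ∈ xs ] ∑[ y ∈ ys ] (p x ν * q y (zipWith _∸_ μ ν))
    ≡⟨ ∑-swap (box μ) xs _ ⟩
  ∑[ x ∈ xs ] ∑[ ν ∈ box μ ] ∑[ y ∈ ys ] (p x ν * q y (zipWith _∸_ μ ν))
    ≡⟨ ∑-cong xs (λ x → ∑-swap (box μ) ys _) ⟩
  ∑[ x ∈ xs ] ∑[ y ∈ ys ] (p x ⊛ q y) μ ∎
  where open ≡-Reasoning

infixl 7 _∘ʰ_

_∘ʰ_ : ∀ {r} → Vec ℕ r → Vec Graph r → Vec ℕ r
γ ∘ʰ Hs = zipWith _*_ γ (sizes Hs)

∘ʰ-⊕ : ∀ {r} (Hs : Vec Graph r) α β → (α ⊕ β) ∘ʰ Hs ≡ α ∘ʰ Hs ⊕ β ∘ʰ Hs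
∘ʰ-⊕ Hs α β = zipWith-distribʳ *-distribʳ-+ (sizes Hs) α β

≤ᵛ-∘ʰ : ∀ {r} (Hs : Vec Graph r) → (∀ i → 1 ≤ n (lookup Hs i)) → ∀ γ → γ ≤ᵛ γ ∘ʰ Hs
≤ᵛ-∘ʰ []       _        []      = []
≤ᵛ-∘ʰ (H ∷ Hs) nonempty (g ∷ γ) =
  subst (_≤ g * n H) (*-identityʳ g) (*-monoʳ-≤ g (nonempty zero)) ∷ ≤ᵛ-∘ʰ Hs (nonempty ∘ suc) γ

-- The spanning part of Z

Zspan : ∀ {r} → Vec Graph r → Graph → Poly r
Zspan Hs A ν = ∑[ γ ∈ box ν ] (χ (γ ∘ʰ Hs ≟ᵛ ν) * χ (iso? A (γ · Hs)))

Z-∑-Zspan : ∀ {r} (Hs : Vec Graph r) G ν → Z Hs G ν ≡ ∑[ S ∈ allSubsets (n G) ] Zspan Hs (induced G S) ν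
Z-∑-Zspan Hs G ν = begin
  Z Hs G ν
    ≡⟨ ∑-filter (λ γ → γ ∘ʰ Hs ≟ᵛ ν) (box ν) (λ γ → ind (γ · Hs) G) ⟩
  ∑[ γ ∈ box ν ] (χ (γ ∘ʰ Hs ≟ᵛ ν) * ind (γ · Hs) G)
    ≡⟨ ∑-cong (box ν) (λ γ → trans (cong (χ (γ ∘ʰ Hs ≟ᵛ ν) *_) (length-filter _ (allSubsets (n G))))
                                   (∑-*ˡ (χ (γ ∘ʰ Hs ≟ᵛ ν)) (allSubsets (n G)) _)) ⟩
  ∑[ γ ∈ box ν ] ∑[ S ∈ allSubsets (n G) ] (χ (γ ∘ʰ Hs ≟ᵛ ν) * χ (iso? (induced G S) (γ · Hs)))
    ≡⟨ ∑-swap (box ν) (allSubsets (n G)) _ ⟩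
  ∑[ S ∈ allSubsets (n G) ] Zspan Hs (induced G S) ν ∎
  where open ≡-Reasoning

Zspan-≅ : ∀ {r} (Hs : Vec Graph r) {A A′} → A ≅ A′ → ∀ ν → Zspan Hs A ν ≡ Zspan Hs A′ ν
Zspan-≅ Hs {A} {A′} f ν =
  ∑-cong (box ν) (λ γ → cong (χ (γ ∘ʰ Hs ≟ᵛ ν) *_) (same-χ {γ · Hs} (iso? A (γ · Hs)) (iso? A′ (γ · Hs))))
  where
    same-χ : ∀ {F} (d : Dec (Iso A F)) (d′ : Dec (Iso A′ F)) → χ d ≡ χ d′
    same-χ (yes _) (yes _) = refl
    same-χ (no  _) (no  _) = refl
    same-χ {F} (yes i) (no ¬i) = ⊥-elim (¬i (≅⇒Iso (≅-trans (≅-sym f) (Iso⇒≅ {A} {F} i))))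
    same-χ {F} (no ¬i) (yes i) = ⊥-elim (¬i (≅⇒Iso (≅-trans f (Iso⇒≅ {A′} {F} i))))

Zspan≢0⇒≅· : ∀ {r} (Hs : Vec Graph r) A ν → Zspan Hs A ν ≢ 0 → ∃ λ γ → A ≅ γ · Hs
Zspan≢0⇒≅· Hs A ν ≢0 =
  let γ , t≢0 = ∑-≢0 (box ν) _ ≢0
  in  γ , Iso⇒≅ {A} {γ · Hs} (proj₂ (χ*χ≢0 (γ ∘ʰ Hs ≟ᵛ ν) (iso? A (γ · Hs)) t≢0))

module _ {r} (Hs : Vec Graph r) (conn : ∀ i → Connected (lookup Hs i))
         (distinct : ∀ i j → i ≢ j → ¬ Iso (lookup Hs i) (lookup Hs j)) where

  Iso-·-unique : ∀ {A} α γ → A ≅ α · Hs → Iso A (γ · Hs) → γ ≡ α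
  Iso-·-unique {A} α γ A≅ i = ·-injective Hs conn distinct γ α (≅-trans (≅-sym (Iso⇒≅ {A} {γ · Hs} i)) A≅)

  Zspan-· : ∀ {A} α → A ≅ α · Hs → ∀ ν → Zspan Hs A ν ≡ χ (α ∘ʰ Hs ≟ᵛ ν)
  Zspan-· {A} α A≅ ν with α ∘ʰ Hs ≟ᵛ ν
  ... | yes refl =
    trans (∑-box-single _ _ α (≤ᵛ-∘ʰ Hs (proj₁ ∘ conn) α)
            (λ γ γ≢α → χ*χ≡0 (γ ∘ʰ Hs ≟ᵛ _) (iso? A (γ · Hs)) (λ _ i → γ≢α (Iso-·-unique α γ A≅ i))))
          (cong₂ _*_ (χ-yes (α ∘ʰ Hs ≟ᵛ _) refl) (χ-yes (iso? A (α · Hs)) (≅⇒Iso A≅)))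
  ... | no α∘ʰ≢ν = ∑-≡0 (box ν) λ γ → χ*χ≡0 (γ ∘ʰ Hs ≟ᵛ ν) (iso? A (γ · Hs))
    (λ γ∘ʰ≡ν i → α∘ʰ≢ν (subst (λ δ → δ ∘ʰ Hs ≡ ν) (Iso-·-unique α γ A≅ i) γ∘ʰ≡ν))

  Zspan-∪-· : ∀ {A B} α β → A ≅ α · Hs → B ≅ β · Hs →
              ∀ μ → Zspan Hs (A ∪ B) μ ≡ (Zspan Hs A ⊛ Zspan Hs B) μ
  Zspan-∪-· {A} {B} α β A≅ B≅ μ = begin
    Zspan Hs (A ∪ B) μ
      ≡⟨ Zspan-· (α ⊕ β) (≅-trans (∪-cong A≅ B≅) (·-⊕ Hs α β)) μ ⟩
    χ ((α ⊕ β) ∘ʰ Hs ≟ᵛ μ)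
      ≡⟨ cong (λ v → χ (v ≟ᵛ μ)) (∘ʰ-⊕ Hs α β) ⟩
    χ (α ∘ʰ Hs ⊕ β ∘ʰ Hs ≟ᵛ μ)
      ≡⟨ δ⊛δ (α ∘ʰ Hs) (β ∘ʰ Hs) μ ⟨
    ((λ ν → χ (α ∘ʰ Hs ≟ᵛ ν)) ⊛ (λ ν → χ (β ∘ʰ Hs ≟ᵛ ν))) μ
      ≡⟨ ⊛-cong (Zspan-· α A≅) (Zspan-· β B≅) μ ⟨
    (Zspan Hs A ⊛ Zspan Hs B) μ ∎
    where open ≡-Reasoning

  Zspan-∪ : ∀ A B μ → Zspan Hs (A ∪ B) μ ≡ (Zspan Hs A ⊛ Zspan Hs B) μ
  Zspan-∪ A B μ with Zspan Hs (A ∪ B) μ ≟ 0 | (Zspan Hs A ⊛ Zspan Hs B) μ ≟ 0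
  ... | yes l≡0 | yes r≡0 = trans l≡0 (sym r≡0)
  ... | no  l≢0 | _       =
    let γ , f = Zspan≢0⇒≅· Hs (A ∪ B) μ l≢0
        splitting {α} {β} _ A≅ B≅ = ·-split Hs conn γ f
    in Zspan-∪-· α β A≅ B≅ μ
  ... | yes _   | no r≢0  =
    let ν , t≢0 = ∑-≢0 (box μ) _ r≢0
        α , A≅ = Zspan≢0⇒≅· Hs A ν (λ e → t≢0 (cong (_* Zspan Hs B (zipWith _∸_ μ ν)) e))
        β , B≅ = Zspan≢0⇒≅· Hs B (zipWith _∸_ μ ν)
                   (λ e → t≢0 (trans (cong (Zspan Hs A ν *_) e) (*-zeroʳ (Zspan Hs A ν))))
    in Zspan-∪-· α β A≅ B≅ μ

∑-allSubsets-++ : ∀ a b (f : Subset (a + b) → ℕ) →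
  ∑ (allSubsets (a + b)) f ≡ ∑[ S₁ ∈ allSubsets a ] ∑[ S₂ ∈ allSubsets b ] f (S₁ ++ S₂)
∑-allSubsets-++ zero    b f = sym (+-identityʳ _)
∑-allSubsets-++ (suc a) b f = begin
  ∑ (allSubsets (suc a + b)) f
    ≡⟨ ∑-concatMap _ (allSubsets (a + b)) f ⟩
  ∑[ S ∈ allSubsets (a + b) ] (f (false ∷ S) + (f (true ∷ S) + 0))
    ≡⟨ ∑-allSubsets-++ a b _ ⟩
  ∑[ S₁ ∈ allSubsets a ] ∑[ S₂ ∈ allSubsets b ] (f (false ∷ S₁ ++ S₂) + (f (true ∷ S₁ ++ S₂) + 0))
    ≡⟨ ∑-cong (allSubsets a) distribute ⟩
  ∑[ S₁ ∈ allSubsets a ] (∑[ S₂ ∈ allSubsets b ] f (false ∷ S₁ ++ S₂) + (∑[ S₂ ∈ allSubsets b ] f (true ∷ S₁ ++ S₂) + 0))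
    ≡⟨ ∑-concatMap _ (allSubsets a) (λ S₁ → ∑[ S₂ ∈ allSubsets b ] f (S₁ ++ S₂)) ⟨
  ∑[ S₁ ∈ allSubsets (suc a) ] ∑[ S₂ ∈ allSubsets b ] f (S₁ ++ S₂) ∎
  where
    open ≡-Reasoning
    distribute : ∀ S₁ →
      ∑[ S₂ ∈ allSubsets b ] (f (false ∷ S₁ ++ S₂) + (f (true ∷ S₁ ++ S₂) + 0)) ≡
      ∑[ S₂ ∈ allSubsets b ] f (false ∷ S₁ ++ S₂) + (∑[ S₂ ∈ allSubsets b ] f (true ∷ S₁ ++ S₂) + 0)
    distribute S₁ = trans (∑-+ (allSubsets b) _ (λ S₂ → f (true ∷ S₁ ++ S₂) + 0))
      (cong (∑[ S₂ ∈ allSubsets b ] f (false ∷ S₁ ++ S₂) +_)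
        (trans (∑-+ (allSubsets b) (λ S₂ → f (true ∷ S₁ ++ S₂)) (λ _ → 0))
               (cong (∑[ S₂ ∈ allSubsets b ] f (true ∷ S₁ ++ S₂) +_) (∑-≡0 (allSubsets b) (λ _ → refl)))))

proposition3p1 : (r : ℕ) (Hs : Vec Graph r) →
    (∀ i → Connected (lookup Hs i)) →
    (∀ i j → i ≢ j → ¬ Iso (lookup Hs i) (lookup Hs j)) →
    (G₁ G₂ : Graph) (μ : Vec ℕ r) →
    Z Hs (G₁ ∪ G₂) μ ≡ (Z Hs G₁ ⊛ Z Hs G₂) μ
proposition3p1 r Hs conn distinct G₁ G₂ μ = begin
  Z Hs (G₁ ∪ G₂) μ
    ≡⟨ Z-∑-Zspan Hs (G₁ ∪ G₂) μ ⟩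
  ∑[ S ∈ allSubsets (n G₁ + n G₂) ] Zspan Hs (induced (G₁ ∪ G₂) S) μ
    ≡⟨ ∑-allSubsets-++ (n G₁) (n G₂) _ ⟩
  ∑[ S₁ ∈ 𝒮₁ ] ∑[ S₂ ∈ 𝒮₂ ] Zspan Hs (induced (G₁ ∪ G₂) (S₁ ++ S₂)) μ
    ≡⟨ ∑-cong 𝒮₁ (λ S₁ → ∑-cong 𝒮₂ (Zspan-induced-∪ S₁)) ⟩
  ∑[ S₁ ∈ 𝒮₁ ] ∑[ S₂ ∈ 𝒮₂ ] (Zspan Hs (induced G₁ S₁) ⊛ Zspan Hs (induced G₂ S₂)) μ
    ≡⟨ ⊛-∑ 𝒮₁ 𝒮₂ (Zspan Hs ∘ induced G₁) (Zspan Hs ∘ induced G₂) μ ⟨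
  ((λ ν → ∑[ S₁ ∈ 𝒮₁ ] Zspan Hs (induced G₁ S₁) ν) ⊛ (λ ν → ∑[ S₂ ∈ 𝒮₂ ] Zspan Hs (induced G₂ S₂) ν)) μ
    ≡⟨ ⊛-cong (Z-∑-Zspan Hs G₁) (Z-∑-Zspan Hs G₂) μ ⟨
  (Z Hs G₁ ⊛ Z Hs G₂) μ ∎
  where
    open ≡-Reasoning
    𝒮₁ : List (Subset (n G₁))
    𝒮₁ = allSubsets (n G₁)
    𝒮₂ : List (Subset (n G₂))
    𝒮₂ = allSubsets (n G₂)
    Zspan-induced-∪ : ∀ S₁ S₂ → Zspan Hs (induced (G₁ ∪ G₂) (S₁ ++ S₂)) μ ≡
                                (Zspan Hs (induced G₁ S₁) ⊛ Zspan Hs (induced G₂ S₂)) μ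
    Zspan-induced-∪ S₁ S₂ =
      trans (Zspan-≅ Hs (≅-sym (induced-∪ G₁ G₂ S₁ S₂)) μ) (Zspan-∪ Hs conn distinct (induced G₁ S₁) (induced G₂ S₂) μ)
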